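{- Let $n\geqslant 5$, let $i,k$ satisfy $2\leqslant k\leqslant n-1$, $1\leqslant i\leqslant n-1$, $i\notin\{k-2,k-1,k,k+1\}$, and let $P_6(i,k)$ be a $6$-prism in $BS_n$ of canonical form $(b_k\,b_i\,b_{k-1}\,b_i)^3$, i.e. the subgraph with vertex set $\{\sigma w,\ \sigma w b_i: w\in\langle b_{k-1},b_k\rangle\}$ for some $\sigma\in Sym_n$ and with the $b_{k-1}$-, $b_k$- and $b_i$-edges among these vertices. Then for every vertex $\pi$ of $P_6(i,k)$ and every $b_{k-1}$-edge $e$ of $P_6(i,k)$ there exists a Hamiltonian path of $P_6(i,k)$ whose end vertices are $\pi$ and a vertex $\tau\in e$ such that the distance $d(\pi,\tau)$ is odd.
   Context: $Sym_n$ is the symmetric group of permutations of $\{1,\dots,n\}$; $b_i=(i\ i+1)$, acting by right multiplication (swapping positions $i$ and $i+1$). The Bubble-sort graph $BS_n=Cay(Sym_n,\{b_1,\dots,b_{n-1}\})$ has $\pi$ adjacent to $\pi b_i$; a $b_t$-edge is an edge $\{\pi,\pi b_t\}$. The subgraph $P_6(i,k)$ is isomorphic to the $6$-prism $C_6\times K_2$. -}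

module Defs where

open import Data.Nat using (ℕ; zero; suc; _∸_; _<_; _≤_; _+_; _*_)
open import Data.Fin using (Fin)
open import Data.Vec using (Vec; []; _∷_)
open import Data.List using (List; []; _∷_; length; _++_; [_])
open import Data.List.Relation.Unary.All using (All)
open import Data.List.Relation.Unary.Linked using (Linked)
open import Data.List.Membership.Propositional using (_∈_)
open import Data.Product using (Σ; ∃; _×_; _,_)
open import Data.Sum using (_⊎_)
open import Relation.Binary.PropositionalEquality using (_≡_)
open import Relation.Nullary using (¬_)
import Data.Vec.Relation.Unary.Unique.Propositional as VU
import Data.List.Relation.Unary.Unique.Propositional as LU

-- A permutation π ∈ Sym_n in one-line notation: the vector (π(1),…,π(n))
-- (entries in Fin n, i.e. values 0..n-1 standing for 1..n) with distinct entries.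
IsPerm : (n : ℕ) → Vec (Fin n) n → Set
IsPerm n π = VU.Unique π

-- Right multiplication by b_i = (i i+1): swap positions i and i+1
-- (positions are 1-based, as in the paper).  Identity if i is out of range.
swapAt : ∀ {A : Set} {n : ℕ} → ℕ → Vec A n → Vec A n
swapAt (suc zero)    (x ∷ y ∷ xs) = y ∷ x ∷ xs
swapAt (suc (suc i)) (x ∷ xs)     = x ∷ swapAt (suc i) xs
swapAt _             xs           = xs

applyWord : ∀ {A : Set} {n : ℕ} → List ℕ → Vec A n → Vec A n
applyWord []       π = π
applyWord (j ∷ js) π = applyWord js (swapAt j π)

WalkBS : (n : ℕ) → Vec (Fin n) n → Vec (Fin n) n → ℕ → Set
WalkBS n π τ m =
  Σ (List ℕ) λ w → length w ≡ m × All (λ j → 1 ≤ j × j ≤ n ∸ 1) w × applyWord w π ≡ τ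

DistBS : (n : ℕ) → Vec (Fin n) n → Vec (Fin n) n → ℕ → Set
DistBS n π τ m = WalkBS n π τ m × (∀ m' → m' < m → ¬ WalkBS n π τ m')

OddNat : ℕ → Set
OddNat m = ∃ λ j → m ≡ 1 + 2 * j

-- Vertex set of P_6(i,k) based at σ:  { σ w , σ w b_i : w ∈ ⟨b_{k-1}, b_k⟩ },
-- elements of ⟨b_{k-1},b_k⟩ being words in b_{k-1}, b_k.
PrismV : (n i k : ℕ) → Vec (Fin n) n → Vec (Fin n) n → Set
PrismV n i k σ v =
  Σ (List ℕ) λ w → All (λ j → j ≡ k ∸ 1 ⊎ j ≡ k) w ×
    (v ≡ applyWord w σ ⊎ v ≡ swapAt i (applyWord w σ))

PrismE : (n i k : ℕ) → Vec (Fin n) n → Vec (Fin n) n → Vec (Fin n) n → Set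
PrismE n i k σ u v =
  PrismV n i k σ u × PrismV n i k σ v ×
  (v ≡ swapAt (k ∸ 1) u ⊎ v ≡ swapAt k u ⊎ v ≡ swapAt i u)

HamPath : (n i k : ℕ) → Vec (Fin n) n → Vec (Fin n) n → Vec (Fin n) n → Set
HamPath n i k σ π τ =
  Σ (List (Vec (Fin n) n)) λ p →
    (∃ λ qs → p ≡ π ∷ (qs ++ [ τ ])) ×
    LU.Unique p ×
    All (PrismV n i k σ) p ×
    (∀ v → PrismV n i k σ v → v ∈ p) ×
    Linked (PrismE n i k σ) p

module Submission where

-- The conditions on i make the entries u, u' of the base vertex σ at positions i, i+1 and x, y, z at
-- positions k-1, k, k+1 two disjoint blocks, so the vertices of the prism are σ with the pair permuted by
-- S₂ and the triple by S₃: the prism is the Cayley graph of S₃ × S₂ on the generators b_{k-1}, b_k, b_i,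
-- and on these 12 labels the required Hamiltonian paths are found by exhaustive search. Distances in
-- BS_n are bounded below by inversions: relabel the block entries by their positions in the source
-- vertex; each adjacent transposition changes the number of inversions by at most one, while the target
-- has one more inversion than the source for each pair of block entries ordered differently in the two
-- labels. A walk of that length inside the prism shows that this bound is the distance.

open import Defs
open import Data.Nat using (ℕ; zero; suc; _+_; _*_; _∸_; _≤_; _<_; _%_; _/_; z≤n; s≤s; _<?_; _≟_)
open import Data.Nat.Properties
open import Data.Nat.DivMod using (m≡m%n+[m/n]*n)
open import Data.Nat.ListAction using (sum)
open import Data.Nat.ListAction.Properties using (sum-↭)
open import Data.Nat.Tactic.RingSolver using (solve-∀)
open import Data.Bool using (Bool; true; false; not; if_then_else_) renaming (_≟_ to _≟ᵇ_)
open import Data.Empty using (⊥-elim)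
open import Data.Fin using (Fin) renaming (_≟_ to _≟ᶠ_)
open import Data.Product using (Σ; ∃; _×_; _,_; proj₁; proj₂)
open import Data.Product.Properties using (≡-dec)
open import Data.Sum using (_⊎_; inj₁; inj₂)
open import Data.Vec as Vec using (Vec; []; _∷_; toList)
open import Data.Vec.Properties using (toList-injective; cast-is-id; toList-++; length-toList)
import Data.Vec.Relation.Unary.All.Properties as VecAllP
open import Data.Vec.Relation.Unary.AllPairs using ([]; _∷_)
import Data.Vec.Relation.Unary.Unique.Propositional as VecUnique
open import Data.List using (List; []; _∷_; _++_; [_]; length; map; filter; concatMap; cartesianProduct; zipWith)
open import Data.List.Properties
  using (length-++; length-map; filter-++; filter-accept; filter-reject; map-cong; map-++; ++-assoc)
open import Data.List.Relation.Binary.Permutation.Propositional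
  using (_↭_; ↭-refl; ↭-prep; ↭-swap; ↭-trans; ↭-sym; ↭⇒↭ₛ)
open import Data.List.Relation.Binary.Permutation.Propositional.Properties
  using (↭-length; filter-↭; map⁺; ++⁺ʳ; ++-comm)
open import Data.List.Relation.Unary.All as All using (All; all?; []; _∷_)
open import Data.List.Relation.Unary.Any using (Any; any?; here; there; satisfied)
open import Data.List.Relation.Unary.AllPairs using ([]; _∷_)
open import Data.List.Relation.Unary.Linked as Linked using (Linked; linked?)
import Data.List.Relation.Unary.All.Properties as AllP
import Data.List.Relation.Unary.Linked.Properties as LinkedP
import Data.List.Relation.Unary.Unique.Propositional.Properties as UniqueP
open import Data.List.Relation.Unary.Unique.Propositional using (Unique)
open import Data.List.Membership.Propositional using (_∈_)
open import Data.List.Relation.Binary.Sublist.Propositional using (_⊆_; []; _∷_; _∷ʳ_; ⊆-refl)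
import Data.List.Relation.Binary.Sublist.Propositional.Properties as Sublist
open import Data.List.Membership.Propositional.Properties using (∈-map⁺; ∈-cartesianProduct⁺)
open import Relation.Binary.Definitions using (DecidableEquality)
open import Relation.Binary.PropositionalEquality
  using (_≡_; _≢_; refl; sym; trans; cong; cong₂; subst; setoid; module ≡-Reasoning)
open import Relation.Nullary using (¬_; Dec; yes; no; does; map′; _×-dec_; _⊎-dec_; _→-dec_)
open import Relation.Nullary.Decidable using (True; toWitness)

private variable
  A B : Set

swapAtL : ℕ → List A → List A
swapAtL (suc zero)    (x ∷ y ∷ xs) = y ∷ x ∷ xs
swapAtL (suc (suc i)) (x ∷ xs)     = x ∷ swapAtL (suc i) xs
swapAtL _             xs           = xs

applyWordL : List ℕ → List A → List A
applyWordL []       xs = xs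
applyWordL (j ∷ js) xs = applyWordL js (swapAtL j xs)

toList-swapAt : ∀ {n} j (v : Vec A n) → toList (swapAt j v) ≡ swapAtL j (toList v)
toList-swapAt zero          v           = refl
toList-swapAt (suc zero)    []          = refl
toList-swapAt (suc zero)    (x ∷ [])    = refl
toList-swapAt (suc zero)    (x ∷ y ∷ v) = refl
toList-swapAt (suc (suc j)) []          = refl
toList-swapAt (suc (suc j)) (x ∷ v)     = cong (x ∷_) (toList-swapAt (suc j) v)

toList-applyWord : ∀ {n} w (v : Vec A n) → toList (applyWord w v) ≡ applyWordL w (toList v)
toList-applyWord []      v = refl
toList-applyWord (j ∷ w) v =
  trans (toList-applyWord w (swapAt j v)) (cong (applyWordL w) (toList-swapAt j v))

toList-injective′ : ∀ {n} {v w : Vec A n} → toList v ≡ toList w → v ≡ w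
toList-injective′ {v = v} {w} eq = trans (sym (cast-is-id refl v)) (toList-injective refl v w eq)

map-swapAtL : ∀ (f : A → B) j xs → map f (swapAtL j xs) ≡ swapAtL j (map f xs)
map-swapAtL f zero          xs           = refl
map-swapAtL f (suc zero)    []           = refl
map-swapAtL f (suc zero)    (x ∷ [])     = refl
map-swapAtL f (suc zero)    (x ∷ y ∷ xs) = refl
map-swapAtL f (suc (suc j)) []           = refl
map-swapAtL f (suc (suc j)) (x ∷ xs)     = cong (f x ∷_) (map-swapAtL f (suc j) xs)

map-applyWordL : ∀ (f : A → B) w xs → map f (applyWordL w xs) ≡ applyWordL w (map f xs)
map-applyWordL f []      xs = refl
map-applyWordL f (j ∷ w) xs =
  trans (map-applyWordL f w (swapAtL j xs)) (cong (applyWordL w) (map-swapAtL f j xs))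

swapAtL-↭ : ∀ j (xs : List A) → swapAtL j xs ↭ xs
swapAtL-↭ zero          xs           = ↭-refl
swapAtL-↭ (suc zero)    []           = ↭-refl
swapAtL-↭ (suc zero)    (x ∷ [])     = ↭-refl
swapAtL-↭ (suc zero)    (x ∷ y ∷ xs) = ↭-swap y x ↭-refl
swapAtL-↭ (suc (suc j)) []           = ↭-refl
swapAtL-↭ (suc (suc j)) (x ∷ xs)     = ↭-prep x (swapAtL-↭ (suc j) xs)

swapAtL-++ʳ : ∀ (P : List A) xs j {m} → m ≡ length P + suc j →
  swapAtL m (P ++ xs) ≡ P ++ swapAtL (suc j) xs
swapAtL-++ʳ []      xs j refl = refl
swapAtL-++ʳ (x ∷ P) xs j refl rewrite +-suc (length P) j =
  cong (x ∷_) (swapAtL-++ʳ P xs j (sym (+-suc (length P) j)))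

swapAtL-++ʳ₃ : ∀ (P M Q : List A) xs j {m} → m ≡ length P + (length M + (length Q + suc j)) →
  swapAtL m (P ++ M ++ Q ++ xs) ≡ P ++ M ++ Q ++ swapAtL (suc j) xs
swapAtL-++ʳ₃ P M Q xs j m≡ = begin
  swapAtL _ (P ++ M ++ Q ++ xs)        ≡⟨ cong (swapAtL _) (reassoc xs) ⟩
  swapAtL _ ((P ++ M ++ Q) ++ xs)      ≡⟨ swapAtL-++ʳ (P ++ M ++ Q) xs j (trans m≡ offset) ⟩
  (P ++ M ++ Q) ++ swapAtL (suc j) xs  ≡⟨ reassoc (swapAtL (suc j) xs) ⟨
  P ++ M ++ Q ++ swapAtL (suc j) xs    ∎
  where
  open ≡-Reasoning
  reassoc : ∀ ys → P ++ M ++ Q ++ ys ≡ (P ++ M ++ Q) ++ ys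
  reassoc ys = sym (trans (++-assoc P (M ++ Q) ys) (cong (P ++_) (++-assoc M Q ys)))
  offset : length P + (length M + (length Q + suc j)) ≡ length (P ++ M ++ Q) + suc j
  offset = begin
    length P + (length M + (length Q + suc j))  ≡⟨ cong (length P +_) (+-assoc (length M) _ _) ⟨
    length P + (length M + length Q + suc j)    ≡⟨ +-assoc (length P) _ _ ⟨
    length P + (length M + length Q) + suc j    ≡⟨ cong (λ t → length P + t + suc j) (length-++ M) ⟨
    length P + length (M ++ Q) + suc j          ≡⟨ cong (_+ suc j) (length-++ P) ⟨
    length (P ++ M ++ Q) + suc j                ∎

module _ {K : Set} (_≟ₖ_ : DecidableEquality K) where

  lookupWith : List (K × ℕ) → K → ℕ
  lookupWith []              _ = 0
  lookupWith ((k , v) ∷ kvs) x = if does (x ≟ₖ k) then v else lookupWith kvs x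

  lookupWith-∈ : ∀ {kvs x v} → Unique (map proj₁ kvs) → (x , v) ∈ kvs → lookupWith kvs x ≡ v
  lookupWith-∈ {(k , _) ∷ _} {x} _ _ with x ≟ₖ k
  lookupWith-∈ _          (here refl)  | yes _    = refl
  lookupWith-∈ (k∉ ∷ _)   (there x∈)   | yes refl = ⊥-elim (All.lookup k∉ (∈-map⁺ proj₁ x∈) refl)
  lookupWith-∈ _          (here refl)  | no x≢x   = ⊥-elim (x≢x refl)
  lookupWith-∈ (_ ∷ uniq) (there x∈)   | no _     = lookupWith-∈ uniq x∈

unique-⊆ : ∀ {xs ys : List A} → xs ⊆ ys → Unique ys → Unique xs
unique-⊆ []         []      = []
unique-⊆ (_ ∷ʳ p)   (_ ∷ u) = unique-⊆ p u
unique-⊆ (refl ∷ p) (h ∷ u) = Sublist.All-resp-⊆ p h ∷ unique-⊆ p u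

unique-++-comm : ∀ (xs : List A) {ys} → Unique (xs ++ ys) → Unique (ys ++ xs)
unique-++-comm {A = A} xs {ys} = Unique-resp-↭ (↭⇒↭ₛ (++-comm xs ys))
  where open import Data.List.Relation.Binary.Permutation.Setoid.Properties (setoid A) using (Unique-resp-↭)

toList-unique : ∀ {n} {v : Vec A n} → VecUnique.Unique v → Unique (toList v)
toList-unique []      = []
toList-unique (h ∷ u) = VecAllP.toList⁺ h ∷ toList-unique u

-- Inversions

smallerIn : ℕ → List ℕ → ℕ
smallerIn a ys = length (filter (_<? a) ys)

inversions : List ℕ → ℕ
inversions []       = 0
inversions (a ∷ xs) = smallerIn a xs + inversions xs

crossInversions : List ℕ → List ℕ → ℕ
crossInversions xs ys = sum (map (λ a → smallerIn a ys) xs)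

smallerIn-↭ : ∀ a {ys ys'} → ys ↭ ys' → smallerIn a ys ≡ smallerIn a ys'
smallerIn-↭ a p = ↭-length (filter-↭ (_<? a) p)

smallerIn-++ : ∀ a ys zs → smallerIn a (ys ++ zs) ≡ smallerIn a ys + smallerIn a zs
smallerIn-++ a ys zs = trans (cong length (filter-++ (_<? a) ys zs)) (length-++ (filter (_<? a) ys))

smallerIn-∷-≤ : ∀ a b ys → smallerIn a (b ∷ ys) ≤ suc (smallerIn a ys)
smallerIn-∷-≤ a b ys with b <? a
... | yes b<a = ≤-reflexive (cong length (filter-accept (_<? a) b<a))
... | no  b≮a = ≤-trans (≤-reflexive (cong length (filter-reject (_<? a) b≮a))) (n≤1+n _)

smallerIn-∷-≥ : ∀ a b ys → smallerIn a ys ≤ smallerIn a (b ∷ ys)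
smallerIn-∷-≥ a b ys with b <? a
... | yes b<a = ≤-trans (n≤1+n _) (≤-reflexive (cong length (sym (filter-accept (_<? a) b<a))))
... | no  b≮a = ≤-reflexive (cong length (sym (filter-reject (_<? a) b≮a)))

crossInversions-↭ : ∀ {xs xs' ys ys'} → xs ↭ xs' → ys ↭ ys' → crossInversions xs ys ≡ crossInversions xs' ys'
crossInversions-↭ {xs} {xs'} {ys} {ys'} p q =
  trans (cong sum (map-cong (λ a → smallerIn-↭ a q) xs)) (sum-↭ (map⁺ (λ a → smallerIn a ys') p))

inversions-++ : ∀ xs ys → inversions (xs ++ ys) ≡ inversions xs + inversions ys + crossInversions xs ys
inversions-++ []       ys = sym (+-identityʳ (inversions ys))
inversions-++ (a ∷ xs) ys = begin
    smallerIn a (xs ++ ys) + inversions (xs ++ ys)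
  ≡⟨ cong₂ _+_ (smallerIn-++ a xs ys) (inversions-++ xs ys) ⟩
    (smallerIn a xs + smallerIn a ys) + (inversions xs + inversions ys + crossInversions xs ys)
  ≡⟨ regroup (smallerIn a xs) (smallerIn a ys) (inversions xs) (inversions ys) (crossInversions xs ys) ⟩
    smallerIn a xs + inversions xs + inversions ys + (smallerIn a ys + crossInversions xs ys) ∎
  where
  open ≡-Reasoning
  regroup : ∀ p q r s t → (p + q) + (r + s + t) ≡ p + r + s + (q + t)
  regroup = solve-∀

inversions-swapAtL : ∀ j xs → inversions (swapAtL j xs) ≤ suc (inversions xs)
inversions-swapAtL zero          xs           = n≤1+n _
inversions-swapAtL (suc zero)    []           = n≤1+n _
inversions-swapAtL (suc zero)    (x ∷ [])     = n≤1+n _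
inversions-swapAtL (suc zero)    (x ∷ y ∷ xs) = begin
    smallerIn y (x ∷ xs) + (smallerIn x xs + inversions xs)
  ≤⟨ +-mono-≤ (smallerIn-∷-≤ y x xs) (+-monoˡ-≤ (inversions xs) (smallerIn-∷-≥ x y xs)) ⟩
    suc (smallerIn y xs) + (smallerIn x (y ∷ xs) + inversions xs)
  ≡⟨ cong suc (regroup (smallerIn y xs) (smallerIn x (y ∷ xs)) (inversions xs)) ⟩
    suc (smallerIn x (y ∷ xs) + (smallerIn y xs + inversions xs)) ∎
  where
  open ≤-Reasoning
  regroup : ∀ p q r → p + (q + r) ≡ q + (p + r)
  regroup = solve-∀
inversions-swapAtL (suc (suc j)) []           = n≤1+n _
inversions-swapAtL (suc (suc j)) (x ∷ xs)     = begin
    smallerIn x (swapAtL (suc j) xs) + inversions (swapAtL (suc j) xs)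
  ≤⟨ +-mono-≤ (≤-reflexive (smallerIn-↭ x (swapAtL-↭ (suc j) xs))) (inversions-swapAtL (suc j) xs) ⟩
    smallerIn x xs + suc (inversions xs)
  ≡⟨ +-suc (smallerIn x xs) (inversions xs) ⟩
    suc (smallerIn x xs + inversions xs) ∎
  where open ≤-Reasoning

inversions-applyWordL : ∀ w xs → inversions (applyWordL w xs) ≤ inversions xs + length w
inversions-applyWordL []      xs = m≤m+n _ 0
inversions-applyWordL (j ∷ w) xs = begin
    inversions (applyWordL w (swapAtL j xs))
  ≤⟨ inversions-applyWordL w (swapAtL j xs) ⟩
    inversions (swapAtL j xs) + length w
  ≤⟨ +-monoˡ-≤ (length w) (inversions-swapAtL j xs) ⟩
    suc (inversions xs) + length w
  ≡⟨ sym (+-suc (inversions xs) (length w)) ⟩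
    inversions xs + suc (length w) ∎
  where open ≤-Reasoning

inversions-middle : ∀ P M S → inversions (P ++ M ++ S) ≡
  inversions M + (inversions P + inversions S + crossInversions M S + crossInversions P (M ++ S))
inversions-middle P M S = begin
    inversions (P ++ M ++ S)
  ≡⟨ inversions-++ P (M ++ S) ⟩
    inversions P + inversions (M ++ S) + crossInversions P (M ++ S)
  ≡⟨ cong (λ t → inversions P + t + crossInversions P (M ++ S)) (inversions-++ M S) ⟩
    inversions P + (inversions M + inversions S + crossInversions M S) + crossInversions P (M ++ S)
  ≡⟨ regroup (inversions P) (inversions M) (inversions S) (crossInversions M S) (crossInversions P (M ++ S)) ⟩
    inversions M + (inversions P + inversions S + crossInversions M S + crossInversions P (M ++ S)) ∎
  where
  open ≡-Reasoning
  regroup : ∀ p m s c d → p + (m + s + c) + d ≡ m + (p + s + c + d)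
  regroup = solve-∀

inversions-↭-block : ∀ P S {M M'} → M ↭ M' →
  inversions (P ++ M ++ S) + inversions M' ≡ inversions (P ++ M' ++ S) + inversions M
inversions-↭-block P S {M} {M'} p = begin
    inversions (P ++ M ++ S) + inversions M'
  ≡⟨ cong (_+ inversions M') (inversions-middle P M S) ⟩
    inversions M + outside M + inversions M'
  ≡⟨ cong (λ t → inversions M + t + inversions M') outside-↭ ⟩
    inversions M + outside M' + inversions M'
  ≡⟨ regroup (inversions M) (outside M') (inversions M') ⟩
    inversions M' + outside M' + inversions M
  ≡⟨ cong (_+ inversions M) (sym (inversions-middle P M' S)) ⟩
    inversions (P ++ M' ++ S) + inversions M ∎
  where
  open ≡-Reasoning
  outside : List ℕ → ℕ
  outside N = inversions P + inversions S + crossInversions N S + crossInversions P (N ++ S)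
  outside-↭ : outside M ≡ outside M'
  outside-↭ = cong₂ (λ s t → inversions P + inversions S + s + t)
    (crossInversions-↭ {ys = S} p ↭-refl) (crossInversions-↭ {xs = P} ↭-refl (++⁺ʳ S p))
  regroup : ∀ m o m' → m + o + m' ≡ m' + o + m
  regroup = solve-∀

blocks : List A → List A → List A → List A → List A → List A
blocks P Q R M N = P ++ M ++ Q ++ N ++ R

map-blocks : ∀ (f : A → B) P Q R M N →
  map f (blocks P Q R M N) ≡ blocks (map f P) (map f Q) (map f R) (map f M) (map f N)
map-blocks f P Q R M N =
  trans (map-++ f P _) (cong (map f P ++_) (trans (map-++ f M _)
    (cong (map f M ++_) (trans (map-++ f Q _) (cong (map f Q ++_) (map-++ f N R))))))

inversions-↭-blocks : ∀ P Q R {M M' N N'} → M ↭ M' → N ↭ N' →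
  inversions (blocks P Q R M N) + (inversions M' + inversions N') ≡
  inversions (blocks P Q R M' N') + (inversions M + inversions N)
inversions-↭-blocks P Q R {M} {M'} {N} {N'} p q = begin
  x + (m' + n')  ≡⟨ +-assoc x m' n' ⟨
  x + m' + n'    ≡⟨ cong (_+ n') (inversions-↭-block P (Q ++ N ++ R) p) ⟩
  y + m + n'     ≡⟨ swap-last y m n' ⟩
  y + n' + m     ≡⟨ cong (_+ m) second-block ⟩
  z + n + m      ≡⟨ swap-last z n m ⟩
  z + m + n      ≡⟨ +-assoc z m n ⟩
  z + (m + n)    ∎
  where
  open ≡-Reasoning
  x = inversions (blocks P Q R M N)
  y = inversions (blocks P Q R M' N)
  z = inversions (blocks P Q R M' N')
  m = inversions M
  m' = inversions M'
  n = inversions N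
  n' = inversions N'
  swap-last : ∀ s t u → s + t + u ≡ s + u + t
  swap-last = solve-∀
  reassoc : ∀ N → blocks P Q R M' N ≡ (P ++ M' ++ Q) ++ N ++ R
  reassoc N = sym (trans (++-assoc P (M' ++ Q) (N ++ R)) (cong (P ++_) (++-assoc M' Q (N ++ R))))
  second-block : y + n' ≡ z + n
  second-block = begin
    y + n'                                      ≡⟨ cong (λ t → inversions t + n') (reassoc N) ⟩
    inversions ((P ++ M' ++ Q) ++ N ++ R) + n'  ≡⟨ inversions-↭-block (P ++ M' ++ Q) R q ⟩
    inversions ((P ++ M' ++ Q) ++ N' ++ R) + n  ≡⟨ cong (λ t → inversions t + n) (reassoc N') ⟨
    z + n                                       ∎

inversions-map-↭-blocks : ∀ (f : A → ℕ) P Q R {M M' N N'} → M ↭ M' → N ↭ N' →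
  inversions (map f (blocks P Q R M N)) + (inversions (map f M') + inversions (map f N')) ≡
  inversions (map f (blocks P Q R M' N')) + (inversions (map f M) + inversions (map f N))
inversions-map-↭-blocks f P Q R {M} {M'} {N} {N'} p q
  rewrite map-blocks f P Q R M N | map-blocks f P Q R M' N' =
  inversions-↭-blocks (map f P) (map f Q) (map f R) (map⁺ f p) (map⁺ f q)

++-⊆-blocks : ∀ (P Q R M N : List A) → M ++ N ⊆ blocks P Q R M N
++-⊆-blocks P Q R M N =
  Sublist.++⁺ˡ P (Sublist.++⁺ (⊆-refl {x = M}) (Sublist.++⁺ˡ Q (Sublist.++⁺ʳ R (⊆-refl {x = N}))))


-- The prism as a Cayley graph of S₃ × S₂

data S₃ : Set where
  e a b ab ba aba : S₃

_·a : S₃ → S₃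
e   ·a = a
a   ·a = e
b   ·a = ba
ab  ·a = aba
ba  ·a = b
aba ·a = ab

_·b : S₃ → S₃
e   ·b = b
a   ·b = ab
b   ·b = e
ab  ·b = a
ba  ·b = aba
aba ·b = ba

code : S₃ → ℕ
code e   = 0
code a   = 1
code b   = 2
code ab  = 3
code ba  = 4
code aba = 5

decode : ℕ → S₃
decode 0 = e
decode 1 = a
decode 2 = b
decode 3 = ab
decode 4 = ba
decode _ = aba

decode-code : ∀ d → decode (code d) ≡ d
decode-code e   = refl
decode-code a   = refl
decode-code b   = refl
decode-code ab  = refl
decode-code ba  = refl
decode-code aba = refl

_≟ₛ_ : DecidableEquality S₃
d ≟ₛ d' = map′ (λ eq → trans (sym (decode-code d)) (trans (cong decode eq) (decode-code d')))
               (cong code) (code d ≟ code d')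

elements : List S₃
elements = e ∷ a ∷ b ∷ ab ∷ ba ∷ aba ∷ []

∈-elements : ∀ d → d ∈ elements
∈-elements e   = here refl
∈-elements a   = there (here refl)
∈-elements b   = there (there (here refl))
∈-elements ab  = there (there (there (here refl)))
∈-elements ba  = there (there (there (there (here refl))))
∈-elements aba = there (there (there (there (there (here refl)))))

arrange₃ : S₃ → A × A × A → List A
arrange₃ e   (x , y , z) = x ∷ y ∷ z ∷ []
arrange₃ a   (x , y , z) = y ∷ x ∷ z ∷ []
arrange₃ b   (x , y , z) = x ∷ z ∷ y ∷ []
arrange₃ ab  (x , y , z) = y ∷ z ∷ x ∷ []
arrange₃ ba  (x , y , z) = z ∷ x ∷ y ∷ []
arrange₃ aba (x , y , z) = z ∷ y ∷ x ∷ []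

arrange₂ : Bool → A × A → List A
arrange₂ false (u , u') = u ∷ u' ∷ []
arrange₂ true  (u , u') = u' ∷ u ∷ []

swapAtL-arrange₃-a : ∀ d (X : A × A × A) xs → swapAtL 1 (arrange₃ d X ++ xs) ≡ arrange₃ (d ·a) X ++ xs
swapAtL-arrange₃-a e   _ _ = refl
swapAtL-arrange₃-a a   _ _ = refl
swapAtL-arrange₃-a b   _ _ = refl
swapAtL-arrange₃-a ab  _ _ = refl
swapAtL-arrange₃-a ba  _ _ = refl
swapAtL-arrange₃-a aba _ _ = refl

swapAtL-arrange₃-b : ∀ d (X : A × A × A) xs → swapAtL 2 (arrange₃ d X ++ xs) ≡ arrange₃ (d ·b) X ++ xs
swapAtL-arrange₃-b e   _ _ = refl
swapAtL-arrange₃-b a   _ _ = refl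
swapAtL-arrange₃-b b   _ _ = refl
swapAtL-arrange₃-b ab  _ _ = refl
swapAtL-arrange₃-b ba  _ _ = refl
swapAtL-arrange₃-b aba _ _ = refl

swapAtL-arrange₂ : ∀ c (U : A × A) xs → swapAtL 1 (arrange₂ c U ++ xs) ≡ arrange₂ (not c) U ++ xs
swapAtL-arrange₂ false _ _ = refl
swapAtL-arrange₂ true  _ _ = refl

map-arrange₃ : ∀ (f : A → B) d x y z → map f (arrange₃ d (x , y , z)) ≡ arrange₃ d (f x , f y , f z)
map-arrange₃ f e   _ _ _ = refl
map-arrange₃ f a   _ _ _ = refl
map-arrange₃ f b   _ _ _ = refl
map-arrange₃ f ab  _ _ _ = refl
map-arrange₃ f ba  _ _ _ = refl
map-arrange₃ f aba _ _ _ = refl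

map-arrange₂ : ∀ (f : A → B) c u u' → map f (arrange₂ c (u , u')) ≡ arrange₂ c (f u , f u')
map-arrange₂ f false _ _ = refl
map-arrange₂ f true  _ _ = refl

arrange₃-↭ : ∀ d (X : A × A × A) → arrange₃ d X ↭ arrange₃ e X
arrange₃-↭ e   _ = ↭-refl
arrange₃-↭ a   _ = ↭-swap _ _ ↭-refl
arrange₃-↭ b   _ = ↭-prep _ (↭-swap _ _ ↭-refl)
arrange₃-↭ ab  _ = ↭-trans (↭-prep _ (↭-swap _ _ ↭-refl)) (↭-swap _ _ ↭-refl)
arrange₃-↭ ba  _ = ↭-trans (↭-swap _ _ ↭-refl) (↭-prep _ (↭-swap _ _ ↭-refl))
arrange₃-↭ aba _ = ↭-trans (↭-prep _ (↭-swap _ _ ↭-refl)) (arrange₃-↭ ba _)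

arrange₂-↭ : ∀ c (U : A × A) → arrange₂ c U ↭ arrange₂ false U
arrange₂-↭ false _ = ↭-refl
arrange₂-↭ true  _ = ↭-swap _ _ ↭-refl

length-arrange₂ : ∀ c (U : A × A) → length (arrange₂ c U) ≡ 2
length-arrange₂ c U = ↭-length (arrange₂-↭ c U)

length-arrange₃ : ∀ d (X : A × A × A) → length (arrange₃ d X) ≡ 3
length-arrange₃ d X = ↭-length (arrange₃-↭ d X)

ranks₃ : S₃ → ℕ × ℕ × ℕ
ranks₃ e   = 0 , 1 , 2
ranks₃ a   = 1 , 0 , 2
ranks₃ b   = 0 , 2 , 1
ranks₃ ab  = 2 , 0 , 1
ranks₃ ba  = 1 , 2 , 0
ranks₃ aba = 2 , 1 , 0

ranks₂ : Bool → ℕ × ℕ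
ranks₂ false = 0 , 1
ranks₂ true  = 1 , 0

arrange₃-ranks₃ : ∀ d → arrange₃ d (ranks₃ d) ≡ 0 ∷ 1 ∷ 2 ∷ []
arrange₃-ranks₃ e   = refl
arrange₃-ranks₃ a   = refl
arrange₃-ranks₃ b   = refl
arrange₃-ranks₃ ab  = refl
arrange₃-ranks₃ ba  = refl
arrange₃-ranks₃ aba = refl

arrange₂-ranks₂ : ∀ c → arrange₂ c (ranks₂ c) ≡ 0 ∷ 1 ∷ []
arrange₂-ranks₂ false = refl
arrange₂-ranks₂ true  = refl

Label : Set
Label = S₃ × Bool

_≟ₗ_ : DecidableEquality Label
_≟ₗ_ = ≡-dec _≟ₛ_ _≟ᵇ_

labels : List Label
labels = cartesianProduct elements (false ∷ true ∷ [])

∈-labels : ∀ l → l ∈ labels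
∈-labels (d , c) = ∈-cartesianProduct⁺ (∈-elements d) (∈-booleans c)
  where
  ∈-booleans : ∀ c → c ∈ false ∷ true ∷ []
  ∈-booleans false = here refl
  ∈-booleans true  = there (here refl)

data Gen : Set where
  bₖ₋₁ bₖ bᵢ : Gen

generators : List Gen
generators = bₖ₋₁ ∷ bₖ ∷ bᵢ ∷ []

step : Gen → Label → Label
step bₖ₋₁ (d , c) = d ·a , c
step bₖ   (d , c) = d ·b , c
step bᵢ   (d , c) = d , not c

steps : List Gen → Label → Label
steps []       l = l
steps (g ∷ gs) l = steps gs (step g l)

word₃ : S₃ → List Gen
word₃ e   = []
word₃ a   = bₖ₋₁ ∷ []
word₃ b   = bₖ ∷ []
word₃ ab  = bₖ₋₁ ∷ bₖ ∷ []
word₃ ba  = bₖ ∷ bₖ₋₁ ∷ []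
word₃ aba = bₖ₋₁ ∷ bₖ ∷ bₖ₋₁ ∷ []

steps-word₃ : ∀ d → steps (word₃ d) (e , false) ≡ (d , false)
steps-word₃ e   = refl
steps-word₃ a   = refl
steps-word₃ b   = refl
steps-word₃ ab  = refl
steps-word₃ ba  = refl
steps-word₃ aba = refl

-- The number of pairs in the two blocks whose relative order differs between the two labels.
distance : Label → Label → ℕ
distance (d , c) (d' , c') = inversions (arrange₂ c' (ranks₂ c)) + inversions (arrange₃ d' (ranks₃ d))

distance-self : ∀ l → distance l l ≡ 0
distance-self (d , c) = cong₂ (λ s t → inversions s + inversions t) (arrange₂-ranks₂ c) (arrange₃-ranks₃ d)

Adjacent : Label → Label → Set
Adjacent l l' = Any (λ g → l' ≡ step g l) generators

Hamiltonian : List Label → Set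
Hamiltonian p = Unique p × All (_∈ p) labels × Linked Adjacent p

Geodesic : Label → Label → List Gen → Set
Geodesic l l' gs = steps gs l ≡ l' × length gs ≡ distance l l'

words : ℕ → List (List Gen)
words zero    = [ [] ]
words (suc m) = concatMap (λ g → map (g ∷_) (words m)) generators

-- The theorem at the level of labels, for the path lp ∷ qs ++ [ τ ].
Witness : Label → Label → List Label × Label → Set
Witness lp lr (qs , τ) =
  (τ ≡ lr ⊎ τ ≡ step bₖ₋₁ lr) × Hamiltonian (lp ∷ qs ++ [ τ ]) × distance lp τ % 2 ≡ 1 ×
  Any (Geodesic lp τ) (words (distance lp τ))

open import Data.List.Membership.DecPropositional _≟ₗ_ using (_∈?_; _∉?_)
open import Data.List.Relation.Unary.Unique.DecPropositional _≟ₗ_ using (unique?)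

-- All simple paths with 12 vertices starting at lp, as pairs (qs , τ) standing for lp ∷ qs ++ [ τ ].
extend : Label → ℕ → List Label × Label → List (List Label × Label)
extend lp zero    path     = [ path ]
extend lp (suc m) (qs , τ) =
  concatMap (λ l → extend lp m (qs ++ [ τ ] , l))
            (filter (_∉? lp ∷ qs ++ [ τ ]) (map (λ g → step g τ) generators))

simplePaths : Label → List (List Label × Label)
simplePaths lp = concatMap (λ l → extend lp 10 ([] , l)) (map (λ g → step g lp) generators)

witness? : ∀ lp lr path → Dec (Witness lp lr path)
witness? lp lr (qs , τ) =
  ((τ ≟ₗ lr) ⊎-dec (τ ≟ₗ step bₖ₋₁ lr)) ×-dec
  (unique? path ×-dec all? (_∈? path) labels ×-dec linked? adjacent? path) ×-dec
  (distance lp τ % 2 ≟ 1) ×-dec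
  any? (λ gs → (steps gs lp ≟ₗ τ) ×-dec (length gs ≟ distance lp τ)) (words (distance lp τ))
  where
  path = lp ∷ qs ++ [ τ ]
  adjacent? : ∀ l l' → Dec (Adjacent l l')
  adjacent? l l' = any? (λ g → l' ≟ₗ step g l) generators

everyLabel : {P : Label → Set} (P? : ∀ l → Dec (P l)) → {True (all? P? labels)} → ∀ l → P l
everyLabel P? {ok} l = All.lookup (toWitness ok) (∈-labels l)

-- Opaque because unfolding them would run the decision procedures again, proof terms included.
opaque
  witness : ∀ lp lr → ∃ (Witness lp lr)
  witness lp lr = satisfied
    (All.lookup (everyLabel (λ lp → all? (λ lr → any? (witness? lp lr) (simplePaths lp)) labels) lp) (∈-labels lr))

  distance-zero : ∀ l l' → distance l l' ≡ 0 → l ≡ l'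
  distance-zero l l' =
    All.lookup (everyLabel (λ l → all? (λ l' → (distance l l' ≟ 0) →-dec (l ≟ₗ l')) labels) l) (∈-labels l')

-- The vertices of the prism in BS_n

position : ℕ → ℕ → Gen → ℕ
position i k bₖ₋₁ = k ∸ 1
position i k bₖ   = k
position i k bᵢ   = i

vertexList : {n : ℕ} → (List (Fin n) → List (Fin n) → List (Fin n)) →
  Fin n × Fin n → Fin n × Fin n × Fin n → Label → List (Fin n)
vertexList glue U X (d , c) = glue (arrange₂ c U) (arrange₃ d X)

odd-from-%2 : ∀ m → m % 2 ≡ 1 → OddNat m
odd-from-%2 m m%2≡1 = m / 2 , (begin
  m                  ≡⟨ m≡m%n+[m/n]*n m 2 ⟩
  m % 2 + m / 2 * 2  ≡⟨ cong₂ _+_ m%2≡1 (*-comm (m / 2) 2) ⟩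
  1 + 2 * (m / 2)    ∎)
  where open ≡-Reasoning

OddHamPathToEdge : (n i k : ℕ) → Vec (Fin n) n → Vec (Fin n) n → Vec (Fin n) n → Set
OddHamPathToEdge n i k σ π ρ = Σ (Vec (Fin n) n) λ τ →
  (τ ≡ ρ ⊎ τ ≡ swapAt (k ∸ 1) ρ) × HamPath n i k σ π τ × Σ ℕ λ m → DistBS n π τ m × OddNat m

-- glue M N is σ with its entries U at positions i, i+1 replaced by M and X at k-1, k, k+1 by N.
record Layout (n i k : ℕ) (σ : Vec (Fin n) n) : Set where
  field
    U        : Fin n × Fin n
    X        : Fin n × Fin n × Fin n
    distinct : Unique (arrange₂ false U ++ arrange₃ e X)
    glue     : List (Fin n) → List (Fin n) → List (Fin n)
    glue-σ   : toList σ ≡ glue (arrange₂ false U) (arrange₃ e X)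
    glue-↭   : ∀ (f : Fin n → ℕ) {M M' N N'} → M ↭ M' → N ↭ N' →
      inversions (map f (glue M N)) + (inversions (map f M') + inversions (map f N')) ≡
      inversions (map f (glue M' N')) + (inversions (map f M) + inversions (map f N))
    glue-swap : ∀ g l → swapAtL (position i k g) (vertexList glue U X l) ≡ vertexList glue U X (step g l)

module Realisation {n i k : ℕ} {σ : Vec (Fin n) n} (layout : Layout n i k σ)
  (bounds : ∀ g → 1 ≤ position i k g × position i k g ≤ n ∸ 1) where

  open Layout layout

  pos : Gen → ℕ
  pos = position i k

  oneLine : Label → List (Fin n)
  oneLine = vertexList glue U X

  vertex : Label → Vec (Fin n) n
  vertex (d , false) = applyWord (map pos (word₃ d)) σ
  vertex (d , true)  = swapAt i (vertex (d , false))

  applyWordL-steps : ∀ gs l → applyWordL (map pos gs) (oneLine l) ≡ oneLine (steps gs l)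
  applyWordL-steps []       l = refl
  applyWordL-steps (g ∷ gs) l =
    trans (cong (applyWordL (map pos gs)) (glue-swap g l)) (applyWordL-steps gs (step g l))

  toList-vertex : ∀ l → toList (vertex l) ≡ oneLine l
  toList-vertex (d , false) = begin
    toList (applyWord (map pos (word₃ d)) σ)         ≡⟨ toList-applyWord (map pos (word₃ d)) σ ⟩
    applyWordL (map pos (word₃ d)) (toList σ)        ≡⟨ cong (applyWordL (map pos (word₃ d))) glue-σ ⟩
    applyWordL (map pos (word₃ d)) (oneLine (e , false)) ≡⟨ applyWordL-steps (word₃ d) (e , false) ⟩
    oneLine (steps (word₃ d) (e , false))               ≡⟨ cong oneLine (steps-word₃ d) ⟩
    oneLine (d , false)                                 ∎
    where open ≡-Reasoning
  toList-vertex (d , true) =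
    trans (toList-swapAt i (vertex (d , false)))
          (trans (cong (swapAtL i) (toList-vertex (d , false))) (glue-swap bᵢ (d , false)))

  swapAt-vertex : ∀ g l → swapAt (pos g) (vertex l) ≡ vertex (step g l)
  swapAt-vertex g l = toList-injective′ (begin
    toList (swapAt (pos g) (vertex l))  ≡⟨ toList-swapAt (pos g) (vertex l) ⟩
    swapAtL (pos g) (toList (vertex l)) ≡⟨ cong (swapAtL (pos g)) (toList-vertex l) ⟩
    swapAtL (pos g) (oneLine l)            ≡⟨ glue-swap g l ⟩
    oneLine (step g l)                     ≡⟨ toList-vertex (step g l) ⟨
    toList (vertex (step g l))          ∎)
    where open ≡-Reasoning

  applyWord-vertex : ∀ gs l → applyWord (map pos gs) (vertex l) ≡ vertex (steps gs l)
  applyWord-vertex []       l = refl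
  applyWord-vertex (g ∷ gs) l =
    trans (cong (applyWord (map pos gs)) (swapAt-vertex g l)) (applyWord-vertex gs (step g l))

  -- Relabels the five entries by their positions in l, so that the blocks of oneLine l become sorted.
  weight : Label → Fin n → ℕ
  weight (d , c) = lookupWith _≟ᶠ_
    (zipWith _,_ (arrange₂ false U ++ arrange₃ e X) (arrange₂ false (ranks₂ c) ++ arrange₃ e (ranks₃ d)))

  weight-arrange₂ : ∀ l c' → map (weight l) (arrange₂ c' U) ≡ arrange₂ c' (ranks₂ (proj₂ l))
  weight-arrange₂ l c' = trans (map-arrange₂ (weight l) c' _ _)
    (cong₂ (λ s t → arrange₂ c' (s , t)) (lookupWith-∈ _≟ᶠ_ distinct (here refl))
                                         (lookupWith-∈ _≟ᶠ_ distinct (there (here refl))))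

  weight-arrange₃ : ∀ l d' → map (weight l) (arrange₃ d' X) ≡ arrange₃ d' (ranks₃ (proj₁ l))
  weight-arrange₃ l d' = trans (map-arrange₃ (weight l) d' _ _ _)
    (cong₃ (λ s t r → arrange₃ d' (s , t , r)) (lookupWith-∈ _≟ᶠ_ distinct (there (there (here refl))))
                                               (lookupWith-∈ _≟ᶠ_ distinct (there (there (there (here refl)))))
                                               (lookupWith-∈ _≟ᶠ_ distinct (there (there (there (there (here refl)))))))
    where
    cong₃ : ∀ {C : Set} (f : ℕ → ℕ → ℕ → C) {s s' t t' r r'} → s ≡ s' → t ≡ t' → r ≡ r' → f s t r ≡ f s' t' r'
    cong₃ f refl refl refl = refl

  blockInversions : (Fin n → ℕ) → Label → ℕ
  blockInversions f (d , c) = inversions (map f (arrange₂ c U)) + inversions (map f (arrange₃ d X))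

  blockInversions-weight : ∀ l l' → blockInversions (weight l) l' ≡ distance l l'
  blockInversions-weight l (d' , c') =
    cong₂ (λ s t → inversions s + inversions t) (weight-arrange₂ l c') (weight-arrange₃ l d')

  weighted-inversions : ∀ l l' →
    inversions (map (weight l) (oneLine l)) + distance l l' ≡ inversions (map (weight l) (oneLine l'))
  weighted-inversions l@(d , c) l'@(d' , c') = begin
    inversions (map f (oneLine l)) + distance l l'
      ≡⟨ cong (inversions (map f (oneLine l)) +_) (blockInversions-weight l l') ⟨
    inversions (map f (oneLine l)) + blockInversions f l'
      ≡⟨ glue-↭ f (↭₂ c c') (↭₃ d d') ⟩
    inversions (map f (oneLine l')) + blockInversions f l
      ≡⟨ cong (inversions (map f (oneLine l')) +_) (trans (blockInversions-weight l l) (distance-self l)) ⟩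
    inversions (map f (oneLine l')) + 0
      ≡⟨ +-identityʳ _ ⟩
    inversions (map f (oneLine l'))                        ∎
    where
    open ≡-Reasoning
    f = weight l
    ↭₂ : ∀ c c' → arrange₂ c U ↭ arrange₂ c' U
    ↭₂ c c' = ↭-trans (arrange₂-↭ c U) (↭-sym (arrange₂-↭ c' U))
    ↭₃ : ∀ d d' → arrange₃ d X ↭ arrange₃ d' X
    ↭₃ d d' = ↭-trans (arrange₃-↭ d X) (↭-sym (arrange₃-↭ d' X))

  distance-lowerBound : ∀ l l' w → applyWordL w (oneLine l) ≡ oneLine l' → distance l l' ≤ length w
  distance-lowerBound l l' w eq = +-cancelˡ-≤ (inversions (map f (oneLine l))) _ _ (begin
    inversions (map f (oneLine l)) + distance l l'  ≡⟨ weighted-inversions l l' ⟩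
    inversions (map f (oneLine l'))                 ≡⟨ cong (λ t → inversions (map f t)) eq ⟨
    inversions (map f (applyWordL w (oneLine l)))   ≡⟨ cong inversions (map-applyWordL f w (oneLine l)) ⟩
    inversions (applyWordL w (map f (oneLine l)))   ≤⟨ inversions-applyWordL w (map f (oneLine l)) ⟩
    inversions (map f (oneLine l)) + length w       ∎)
    where
    open ≤-Reasoning
    f = weight l

  vertex-distance : ∀ l l' w → applyWord w (vertex l) ≡ vertex l' → distance l l' ≤ length w
  vertex-distance l l' w eq = distance-lowerBound l l' w (begin
    applyWordL w (oneLine l)            ≡⟨ cong (applyWordL w) (toList-vertex l) ⟨
    applyWordL w (toList (vertex l)) ≡⟨ toList-applyWord w (vertex l) ⟨
    toList (applyWord w (vertex l))  ≡⟨ cong toList eq ⟩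
    toList (vertex l')               ≡⟨ toList-vertex l' ⟩
    oneLine l'                          ∎)
    where open ≡-Reasoning

  vertex-injective : ∀ {l l'} → vertex l ≡ vertex l' → l ≡ l'
  vertex-injective {l} {l'} eq = distance-zero l l' (n≤0⇒n≡0 (vertex-distance l l' [] eq))

  word₃-∈-⟨bₖ₋₁,bₖ⟩ : ∀ d → All (λ j → j ≡ k ∸ 1 ⊎ j ≡ k) (map pos (word₃ d))
  word₃-∈-⟨bₖ₋₁,bₖ⟩ e   = []
  word₃-∈-⟨bₖ₋₁,bₖ⟩ a   = inj₁ refl ∷ []
  word₃-∈-⟨bₖ₋₁,bₖ⟩ b   = inj₂ refl ∷ []
  word₃-∈-⟨bₖ₋₁,bₖ⟩ ab  = inj₁ refl ∷ inj₂ refl ∷ []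
  word₃-∈-⟨bₖ₋₁,bₖ⟩ ba  = inj₂ refl ∷ inj₁ refl ∷ []
  word₃-∈-⟨bₖ₋₁,bₖ⟩ aba = inj₁ refl ∷ inj₂ refl ∷ inj₁ refl ∷ []

  vertex-∈-prism : ∀ l → PrismV n i k σ (vertex l)
  vertex-∈-prism (d , false) = map pos (word₃ d) , word₃-∈-⟨bₖ₋₁,bₖ⟩ d , inj₁ refl
  vertex-∈-prism (d , true)  = map pos (word₃ d) , word₃-∈-⟨bₖ₋₁,bₖ⟩ d , inj₂ refl

  applyWord-⟨bₖ₋₁,bₖ⟩ : ∀ w → All (λ j → j ≡ k ∸ 1 ⊎ j ≡ k) w →
    ∀ l → ∃ λ l' → applyWord w (vertex l) ≡ vertex l'
  applyWord-⟨bₖ₋₁,bₖ⟩ []      []              l = l , refl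
  applyWord-⟨bₖ₋₁,bₖ⟩ (_ ∷ w) (inj₁ refl ∷ ws) l =
    let l' , eq = applyWord-⟨bₖ₋₁,bₖ⟩ w ws (step bₖ₋₁ l)
    in l' , trans (cong (applyWord w) (swapAt-vertex bₖ₋₁ l)) eq
  applyWord-⟨bₖ₋₁,bₖ⟩ (_ ∷ w) (inj₂ refl ∷ ws) l =
    let l' , eq = applyWord-⟨bₖ₋₁,bₖ⟩ w ws (step bₖ l)
    in l' , trans (cong (applyWord w) (swapAt-vertex bₖ l)) eq

  prism-vertex : ∀ {v} → PrismV n i k σ v → ∃ λ l → v ≡ vertex l
  prism-vertex (w , ws , inj₁ refl) = applyWord-⟨bₖ₋₁,bₖ⟩ w ws (e , false)
  prism-vertex (w , ws , inj₂ refl) =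
    let l , eq = applyWord-⟨bₖ₋₁,bₖ⟩ w ws (e , false)
    in step bᵢ l , trans (cong (swapAt i) eq) (swapAt-vertex bᵢ l)

  adjacent-edge : ∀ {l l'} → Adjacent l l' → PrismE n i k σ (vertex l) (vertex l')
  adjacent-edge {l} (here refl) =
    vertex-∈-prism l , vertex-∈-prism (step bₖ₋₁ l) , inj₁ (sym (swapAt-vertex bₖ₋₁ l))
  adjacent-edge {l} (there (here refl)) =
    vertex-∈-prism l , vertex-∈-prism (step bₖ l) , inj₂ (inj₁ (sym (swapAt-vertex bₖ l)))
  adjacent-edge {l} (there (there (here refl))) =
    vertex-∈-prism l , vertex-∈-prism (step bᵢ l) , inj₂ (inj₂ (sym (swapAt-vertex bᵢ l)))

  geodesic-distance : ∀ {l l' gs} → Geodesic l l' gs → DistBS n (vertex l) (vertex l') (distance l l')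
  geodesic-distance {l} {l'} {gs} (refl , length≡) = walk , shorter-walks-fail
    where
    walk : WalkBS n (vertex l) (vertex l') (distance l l')
    walk = map pos gs , trans (length-map pos gs) length≡ ,
           AllP.map⁺ (All.universal bounds gs) , applyWord-vertex gs l
    shorter-walks-fail : ∀ m → m < distance l l' → ¬ WalkBS n (vertex l) (vertex l') m
    shorter-walks-fail m m<d (w , refl , _ , eq) = <⇒≱ m<d (vertex-distance l l' w eq)

  realise : ∀ lp lr {qs τ} → Witness lp lr (qs , τ) → OddHamPathToEdge n i k σ (vertex lp) (vertex lr)
  realise lp lr {qs} {τ} (end , (unique , covers , linked) , odd , geodesic) =
    vertex τ , on-edge end , hamiltonian , distance lp τ ,
    geodesic-distance {gs = proj₁ (satisfied geodesic)} (proj₂ (satisfied geodesic)) , odd-from-%2 (distance lp τ) odd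
    where
    path = lp ∷ qs ++ [ τ ]
    on-edge : τ ≡ lr ⊎ τ ≡ step bₖ₋₁ lr → vertex τ ≡ vertex lr ⊎ vertex τ ≡ swapAt (k ∸ 1) (vertex lr)
    on-edge (inj₁ refl) = inj₁ refl
    on-edge (inj₂ refl) = inj₂ (sym (swapAt-vertex bₖ₋₁ lr))
    covering : ∀ v → PrismV n i k σ v → v ∈ map vertex path
    covering v v∈ with prism-vertex v∈
    ... | l , refl = ∈-map⁺ vertex (All.lookup covers (∈-labels l))
    hamiltonian : HamPath n i k σ (vertex lp) (vertex τ)
    hamiltonian = map vertex path , (map vertex qs , cong (vertex lp ∷_) (map-++ vertex qs [ τ ])) ,
      UniqueP.map⁺ vertex-injective unique , AllP.map⁺ (All.universal vertex-∈-prism path) ,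
      covering , LinkedP.map⁺ (Linked.map adjacent-edge linked)

  odd-hamiltonian-paths : ∀ {π ρ} → PrismV n i k σ π → PrismV n i k σ ρ → OddHamPathToEdge n i k σ π ρ
  odd-hamiltonian-paths π∈ ρ∈ with prism-vertex π∈ | prism-vertex ρ∈
  ... | lp , refl | lr , refl = realise lp lr (proj₂ (witness lp lr))

-- Positions of the two blocks

module _ {n i k : ℕ} {σ : Vec (Fin n) n} (σ-unique : Unique (toList σ))
         (P Q R : List (Fin n)) {p q : ℕ} (P-length : length P ≡ p) (Q-length : length Q ≡ q)
         (U : Fin n × Fin n) (X : Fin n × Fin n × Fin n) where

  after-P : ∀ {m} j → m ≡ p + suc j → m ≡ length P + suc j
  after-P j m≡ rewrite P-length = m≡

  after-Q : ∀ {m} (M : List (Fin n)) j → m ≡ p + (length M + (q + suc j)) →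
    m ≡ length P + (length M + (length Q + suc j))
  after-Q M j m≡ rewrite P-length | Q-length = m≡

  pairBeforeTriple : toList σ ≡ blocks P Q R (arrange₂ false U) (arrange₃ e X) →
    i ≡ p + 1 → k ∸ 1 ≡ p + (2 + (q + 1)) → k ≡ p + (2 + (q + 2)) → Layout n i k σ
  pairBeforeTriple σ≡ i≡ k∸1≡ k≡ = record
    { U         = U
    ; X         = X
    ; distinct  = unique-⊆ (++-⊆-blocks P Q R (arrange₂ false U) (arrange₃ e X)) (subst Unique σ≡ σ-unique)
    ; glue      = blocks P Q R
    ; glue-σ    = σ≡
    ; glue-↭    = λ f → inversions-map-↭-blocks f P Q R
    ; glue-swap = swap
    }
    where
    past-pair : ∀ c {m} j → m ≡ p + (2 + (q + suc j)) →
      m ≡ length P + (length (arrange₂ c U) + (length Q + suc j))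
    past-pair c j m≡ = after-Q (arrange₂ c U) j (trans m≡ (cong (λ t → p + (t + (q + suc j))) (sym (length-arrange₂ c U))))
    swap : ∀ g l → swapAtL (position i k g) (vertexList (blocks P Q R) U X l) ≡ vertexList (blocks P Q R) U X (step g l)
    swap bₖ₋₁ (d , c) = trans (swapAtL-++ʳ₃ P (arrange₂ c U) Q _ 0 (past-pair c 0 k∸1≡))
                              (cong (λ t → P ++ arrange₂ c U ++ Q ++ t) (swapAtL-arrange₃-a d X R))
    swap bₖ   (d , c) = trans (swapAtL-++ʳ₃ P (arrange₂ c U) Q _ 1 (past-pair c 1 k≡))
                              (cong (λ t → P ++ arrange₂ c U ++ Q ++ t) (swapAtL-arrange₃-b d X R))
    swap bᵢ   (d , c) = trans (swapAtL-++ʳ P _ 0 (after-P 0 i≡)) (cong (P ++_) (swapAtL-arrange₂ c U _))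

  tripleBeforePair : toList σ ≡ blocks P Q R (arrange₃ e X) (arrange₂ false U) →
    k ∸ 1 ≡ p + 1 → k ≡ p + 2 → i ≡ p + (3 + (q + 1)) → Layout n i k σ
  tripleBeforePair σ≡ k∸1≡ k≡ i≡ = record
    { U         = U
    ; X         = X
    ; distinct  = unique-++-comm (arrange₃ e X) (unique-⊆ (++-⊆-blocks P Q R (arrange₃ e X) (arrange₂ false U))
                                             (subst Unique σ≡ σ-unique))
    ; glue      = λ M N → blocks P Q R N M
    ; glue-↭    = exchange
    ; glue-σ    = σ≡
    ; glue-swap = swap
    }
    where
    exchange : ∀ (f : Fin n → ℕ) {M M' N N'} → M ↭ M' → N ↭ N' →
      inversions (map f (blocks P Q R N M)) + (inversions (map f M') + inversions (map f N')) ≡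
      inversions (map f (blocks P Q R N' M')) + (inversions (map f M) + inversions (map f N))
    exchange f {M} {M'} {N} {N'} M↭ N↭ = begin
      inv (blocks P Q R N M) + (inv M' + inv N')    ≡⟨ cong (inv (blocks P Q R N M) +_) (+-comm (inv M') (inv N')) ⟩
      inv (blocks P Q R N M) + (inv N' + inv M')    ≡⟨ inversions-map-↭-blocks f P Q R N↭ M↭ ⟩
      inv (blocks P Q R N' M') + (inv N + inv M)    ≡⟨ cong (inv (blocks P Q R N' M') +_) (+-comm (inv N) (inv M)) ⟩
      inv (blocks P Q R N' M') + (inv M + inv N)    ∎
      where
      open ≡-Reasoning
      inv : List (Fin n) → ℕ
      inv xs = inversions (map f xs)
    past-triple : ∀ d {m} → m ≡ p + (3 + (q + 1)) → m ≡ length P + (length (arrange₃ d X) + (length Q + 1))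
    past-triple d m≡ = after-Q (arrange₃ d X) 0 (trans m≡ (cong (λ t → p + (t + (q + 1))) (sym (length-arrange₃ d X))))
    swap : ∀ g l → swapAtL (position i k g) (vertexList (λ M N → blocks P Q R N M) U X l) ≡
                   vertexList (λ M N → blocks P Q R N M) U X (step g l)
    swap bₖ₋₁ (d , c) = trans (swapAtL-++ʳ P _ 0 (after-P 0 k∸1≡)) (cong (P ++_) (swapAtL-arrange₃-a d X _))
    swap bₖ   (d , c) = trans (swapAtL-++ʳ P _ 1 (after-P 1 k≡)) (cong (P ++_) (swapAtL-arrange₃-b d X _))
    swap bᵢ   (d , c) = trans (swapAtL-++ʳ₃ P (arrange₃ d X) Q _ 0 (past-triple d i≡))
                              (cong (λ t → P ++ arrange₃ d X ++ Q ++ t) (swapAtL-arrange₂ c U R))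
data Positions (n i k : ℕ) : Set where
  pair-first   : ∀ p q r → i ≡ p + 1 → k ∸ 1 ≡ p + (2 + (q + 1)) → k ≡ p + (2 + (q + 2)) →
                 n ≡ p + (2 + (q + (3 + r))) → Positions n i k
  triple-first : ∀ p q r → k ∸ 1 ≡ p + 1 → k ≡ p + 2 → i ≡ p + (3 + (q + 1)) →
                 n ≡ p + (3 + (q + (2 + r))) → Positions n i k

block-positions : ∀ {n i k} → 2 ≤ k → k ≤ n ∸ 1 → 1 ≤ i → i ≤ n ∸ 1 →
  i ≢ k ∸ 2 → i ≢ k ∸ 1 → i ≢ k → i ≢ k + 1 → Positions n i k
block-positions {zero} (s≤s (s≤s _)) ()
block-positions {suc n} {i} {suc (suc k₀)} (s≤s (s≤s _)) k≤n 1≤i i≤n _ _ _ _ with i <? k₀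
... | yes i<k₀ with m≤n⇒∃[o]m+o≡n i<k₀ | m≤n⇒∃[o]m+o≡n 1≤i | m≤n⇒∃[o]m+o≡n k≤n
...   | q , refl | p , refl | r , refl = pair-first p q r (+-comm 1 p) (k∸1≡ p q) (k≡ p q) (n≡ p q r)
  where
  k∸1≡ : ∀ p q → 3 + p + q ≡ p + (2 + (q + 1))
  k∸1≡ = solve-∀
  k≡ : ∀ p q → 4 + p + q ≡ p + (2 + (q + 2))
  k≡ = solve-∀
  n≡ : ∀ p q r → 5 + p + q + r ≡ p + (2 + (q + (3 + r)))
  n≡ = solve-∀
block-positions {suc n} {i} {suc (suc k₀)} (s≤s (s≤s _)) k≤n 1≤i i≤n i≢k₀ i≢k₀+1 i≢k₀+2 i≢k₀+3
  | no i≮k₀ with m≤n⇒∃[o]m+o≡n (≮⇒≥ i≮k₀) | m≤n⇒∃[o]m+o≡n i≤n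
... | 0 , refl | _ = ⊥-elim (i≢k₀ (+-identityʳ k₀))
... | 1 , refl | _ = ⊥-elim (i≢k₀+1 (+-comm k₀ 1))
... | 2 , refl | _ = ⊥-elim (i≢k₀+2 (+-comm k₀ 2))
... | 3 , refl | _ = ⊥-elim (i≢k₀+3 (trans (+-comm k₀ 3) (cong (2 +_) (+-comm 1 k₀))))
... | suc (suc (suc (suc q))) , refl | r , refl =
  triple-first k₀ q r (+-comm 1 k₀) (+-comm 2 k₀) (i≡ k₀ q) (n≡ k₀ q r)
  where
  i≡ : ∀ p q → p + (4 + q) ≡ p + (3 + (q + 1))
  i≡ = solve-∀
  n≡ : ∀ p q r → 1 + (p + (4 + q) + r) ≡ p + (3 + (q + (2 + r)))
  n≡ = solve-∀

splitBlocks : ∀ p m q m' r (v : Vec A (p + (m + (q + (m' + r))))) →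
  Σ (List A) λ P → Σ (Vec A m) λ M → Σ (List A) λ Q → Σ (Vec A m') λ N → Σ (List A) λ R →
  toList v ≡ blocks P Q R (toList M) (toList N) × length P ≡ p × length Q ≡ q
splitBlocks p m q m' r v with Vec.splitAt p v
... | P , v₁ , refl with Vec.splitAt m v₁
... | M , v₂ , refl with Vec.splitAt q v₂
... | Q , v₃ , refl with Vec.splitAt m' v₃
... | N , R , refl =
  toList P , M , toList Q , N , toList R ,
  trans (toList-++ P _) (cong (toList P ++_) (trans (toList-++ M _) (cong (toList M ++_)
    (trans (toList-++ Q _) (cong (toList Q ++_) (toList-++ N R)))))) ,
  length-toList P , length-toList Q

position-bounds : ∀ {n i k} → 2 ≤ k → k ≤ n ∸ 1 → 1 ≤ i → i ≤ n ∸ 1 →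
  ∀ g → 1 ≤ position i k g × position i k g ≤ n ∸ 1
position-bounds 2≤k k≤n 1≤i i≤n bₖ₋₁ = ∸-monoˡ-≤ 1 2≤k , ≤-trans (m∸n≤m _ 1) k≤n
position-bounds 2≤k k≤n 1≤i i≤n bₖ   = ≤-trans (s≤s z≤n) 2≤k , k≤n
position-bounds 2≤k k≤n 1≤i i≤n bᵢ   = 1≤i , i≤n

prism-paths : ∀ {n i k} {σ π ρ : Vec (Fin n) n} → Positions n i k → Unique (toList σ) →
  (∀ g → 1 ≤ position i k g × position i k g ≤ n ∸ 1) →
  PrismV n i k σ π → PrismV n i k σ ρ → OddHamPathToEdge n i k σ π ρ
prism-paths {σ = σ} (pair-first p q r i≡ k∸1≡ k≡ refl) σ-unique bounds with splitBlocks p 2 q 3 r σ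
... | P , u ∷ u' ∷ [] , Q , x ∷ y ∷ z ∷ [] , R , σ≡ , P-length , Q-length = Realisation.odd-hamiltonian-paths
  (pairBeforeTriple σ-unique P Q R P-length Q-length (u , u') (x , y , z) σ≡ i≡ k∸1≡ k≡) bounds
prism-paths {σ = σ} (triple-first p q r k∸1≡ k≡ i≡ refl) σ-unique bounds with splitBlocks p 3 q 2 r σ
... | P , x ∷ y ∷ z ∷ [] , Q , u ∷ u' ∷ [] , R , σ≡ , P-length , Q-length = Realisation.odd-hamiltonian-paths
  (tripleBeforePair σ-unique P Q R P-length Q-length (u , u') (x , y , z) σ≡ k∸1≡ k≡ i≡) bounds

lemma1 : (n i k : ℕ) → 5 ≤ n → 2 ≤ k → k ≤ n ∸ 1 → 1 ≤ i → i ≤ n ∸ 1 →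
    i ≢ k ∸ 2 → i ≢ k ∸ 1 → i ≢ k → i ≢ k + 1 →
    (σ : Vec (Fin n) n) → IsPerm n σ →
    (π : Vec (Fin n) n) → PrismV n i k σ π →
    (ρ : Vec (Fin n) n) → PrismV n i k σ ρ →
    Σ (Vec (Fin n) n) λ τ →
      (τ ≡ ρ ⊎ τ ≡ swapAt (k ∸ 1) ρ) ×
      HamPath n i k σ π τ ×
      Σ ℕ λ m → DistBS n π τ m × OddNat m
lemma1 n i k _ 2≤k k≤n∸1 1≤i i≤n∸1 i≢k∸2 i≢k∸1 i≢k i≢k+1 σ σ-perm π π∈ ρ ρ∈ =
  prism-paths (block-positions 2≤k k≤n∸1 1≤i i≤n∸1 i≢k∸2 i≢k∸1 i≢k i≢k+1) (toList-unique σ-perm)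
              (position-bounds {n} 2≤k k≤n∸1 1≤i i≤n∸1) π∈ ρ∈
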